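{- For every quasi-discrete closure model $\mathcal{M}=(X,\vec{\mathcal{C}},\mathcal{V})$ and all $x_1,x_2\in X$: $x_1$ and $x_2$ satisfy exactly the same ISLCS formulas if and only if $x_1$ and $x_2$ are $\mathcal{C}$-bisimilar.
   Context: For $R\subseteq X\times X$ on a non-empty set $X$, let $\mathcal{C}_R(A)=A\cup\{x:\exists a\in A,(a,x)\in R\}$. A QdCM is $(X,\vec{\mathcal{C}},\mathcal{V})$ with $\vec{\mathcal{C}}=\mathcal{C}_R$ for some $R$, $\mathcal{V}:AP\to\mathcal{P}(X)$ for a fixed set $AP$; $\mathcal{V}^{ -1}(x)=\{p:x\in\mathcal{V}(p)\}$; $\overleftarrow{\mathcal{C}}=\mathcal{C}_{R^{ -1}}$. Paths: with $\mathcal{C}_{succ}(N')=N'\cup\{n+1:n\in N'\}$ for $N'\subseteq\mathbb{N}$, a path is a function $\pi:\mathbb{N}\to X$ with $\pi(\mathcal{C}_{succ}(N'))\subseteq\vec{\mathcal{C}}(\pi(N'))$ for all $N'\subseteq\mathbb{N}$. ISLCS formulas: $\Phi::=p\mid\neg\Phi\mid\bigwedge_{i\in I}\Phi_i\mid\vec{\rho}\,\Phi_1[\Phi_2]\mid\overleftarrow{\rho}\,\Phi_1[\Phi_2]$ ($p\in AP$, $I$ an arbitrary index set). Semantics: $x\models p$ iff $x\in\mathcal{V}(p)$; $\neg,\bigwedge$ as usual; $x\models\vec{\rho}\,\Phi_1[\Phi_2]$ iff there are a path $\pi$ and $\ell\in\mathbb{N}$ with $\pi(0)=x$, $\pi(\ell)\models\Phi_1$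 and $\pi(j)\models\Phi_2$ for all $0<j<\ell$; $x\models\overleftarrow{\rho}\,\Phi_1[\Phi_2]$ iff there are a path $\pi$ and $\ell$ with $\pi(\ell)=x$, $\pi(0)\models\Phi_1$ and $\pi(j)\models\Phi_2$ for all $0<j<\ell$. $\mathcal{C}$-bisimulation: non-empty $B\subseteq X\times X$ such that whenever $(x_1,x_2)\in B$: (1) $\mathcal{V}^{ -1}(x_1)=\mathcal{V}^{ -1}(x_2)$; (2) for all $x_1'\in\vec{\mathcal{C}}(\{x_1\})$ there is $x_2'\in\vec{\mathcal{C}}(\{x_2\})$ with $(x_1',x_2')\in B$; (3) for all $x_2'\in\vec{\mathcal{C}}(\{x_2\})$ there is $x_1'\in\vec{\mathcal{C}}(\{x_1\})$ with $(x_1',x_2')\in B$; (4),(5): as (2),(3) with $\overleftarrow{\mathcal{C}}$ in place of $\vec{\mathcal{C}}$. $\mathcal{C}$-bisimilar: contained in some $\mathcal{C}$-bisimulation. -}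

module Defs where

open import Level using (0ℓ; suc; Lift)
open import Data.Nat using (ℕ)
import Data.Nat
open import Data.Product using (Σ; _×_; _,_)
open import Data.Sum using (_⊎_)
open import Data.Empty using (⊥)
open import Relation.Nullary using (¬_)
open import Relation.Unary using (Pred; _∈_)
open import Relation.Binary using (Rel)
open import Relation.Binary.PropositionalEquality using (_≡_)
open import Function using (flip)
open import Function.Bundles using (_⇔_)

𝒞 : {X : Set} → Rel X 0ℓ → Pred X 0ℓ → Pred X 0ℓ
𝒞 {X} R A x = A x ⊎ Σ X (λ a → A a × R a x)

𝒞succ : Pred ℕ 0ℓ → Pred ℕ 0ℓ
𝒞succ N' m = N' m ⊎ Σ ℕ (λ n → N' n × m ≡ Data.Nat.suc n)

image : {A B : Set} → (A → B) → Pred A 0ℓ → Pred B 0ℓ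
image {A} f S b = Σ A (λ a → S a × f a ≡ b)

⟪_⟫ : {X : Set} → X → Pred X 0ℓ
⟪ x ⟫ y = x ≡ y

-- Quasi-discrete closure model over the set AP of atomic propositions.
-- The closure operator is C_R for the relation R.
record QdCM (AP : Set) : Set₁ where
  field
    X        : Set
    nonempty : X
    R        : Rel X 0ℓ
    𝒱        : AP → Pred X 0ℓ

  C→ : Pred X 0ℓ → Pred X 0ℓ
  C→ = 𝒞 R

  C← : Pred X 0ℓ → Pred X 0ℓ
  C← = 𝒞 (flip R)

  𝒱⁻¹ : X → Pred AP 0ℓ
  𝒱⁻¹ x p = x ∈ 𝒱 p

  IsPath : (ℕ → X) → Set₁
  IsPath π = (N' : Pred ℕ 0ℓ) (m : ℕ) → m ∈ 𝒞succ N' → π m ∈ C→ (image π N')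

data Formula (AP : Set) : Set₁ where
  atom : AP → Formula AP
  ¬ᶠ   : Formula AP → Formula AP
  ⋀    : {I : Set} → (I → Formula AP) → Formula AP
  ρ→   : Formula AP → Formula AP → Formula AP
  ρ←   : Formula AP → Formula AP → Formula AP

module Semantics {AP : Set} (M : QdCM AP) where
  open QdCM M

  infix 4 _⊨_
  _⊨_ : X → Formula AP → Set₁
  x ⊨ atom p   = Lift (suc 0ℓ) (x ∈ 𝒱 p)
  x ⊨ ¬ᶠ Φ     = ¬ (x ⊨ Φ)
  x ⊨ ⋀ {I} Φ  = (i : I) → x ⊨ Φ i
  x ⊨ ρ→ Φ₁ Φ₂ = Σ (ℕ → X) λ π → IsPath π × Σ ℕ λ ℓ →
                   π 0 ≡ x × π ℓ ⊨ Φ₁ × ((j : ℕ) → 0 Data.Nat.< j → j Data.Nat.< ℓ → π j ⊨ Φ₂)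
  x ⊨ ρ← Φ₁ Φ₂ = Σ (ℕ → X) λ π → IsPath π × Σ ℕ λ ℓ →
                   π ℓ ≡ x × π 0 ⊨ Φ₁ × ((j : ℕ) → 0 Data.Nat.< j → j Data.Nat.< ℓ → π j ⊨ Φ₂)

  LogEquiv : X → X → Set₁
  LogEquiv x₁ x₂ = (Φ : Formula AP) → (x₁ ⊨ Φ) ⇔ (x₂ ⊨ Φ)

  SameSet : Pred AP 0ℓ → Pred AP 0ℓ → Set
  SameSet A B = (p : AP) → A p ⇔ B p

  IsCBisimulation : Rel X 0ℓ → Set
  IsCBisimulation B =
    Σ X (λ a → Σ X (λ b → B a b)) ×
    ((x₁ x₂ : X) → B x₁ x₂ →
        SameSet (𝒱⁻¹ x₁) (𝒱⁻¹ x₂)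
      × ((x₁' : X) → x₁' ∈ C→ ⟪ x₁ ⟫ → Σ X λ x₂' → x₂' ∈ C→ ⟪ x₂ ⟫ × B x₁' x₂')
      × ((x₂' : X) → x₂' ∈ C→ ⟪ x₂ ⟫ → Σ X λ x₁' → x₁' ∈ C→ ⟪ x₁ ⟫ × B x₁' x₂')
      × ((x₁' : X) → x₁' ∈ C← ⟪ x₁ ⟫ → Σ X λ x₂' → x₂' ∈ C← ⟪ x₂ ⟫ × B x₁' x₂')
      × ((x₂' : X) → x₂' ∈ C← ⟪ x₂ ⟫ → Σ X λ x₁' → x₁' ∈ C← ⟪ x₁ ⟫ × B x₁' x₂'))

  CBisimilar : X → X → Set₁
  CBisimilar x₁ x₂ = Σ (Rel X 0ℓ) λ B → IsCBisimulation B × B x₁ x₂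

-- Bisimilar points agree on every formula: a bisimulation lifts each path
-- step by step, and a backward path is handled by reversing it, lifting it
-- along the converse relation and reversing again. Conversely, logical
-- equivalence is itself a bisimulation. If a successor x₁' of x₁ had no
-- logically equivalent successor of x₂, the infinitary conjunction Ψ of
-- formulas separating x₁' from each successor of x₂ would give a formula
-- ρ→ Ψ [⊥] true at x₁ and false at x₂; predecessors are handled with ρ←.
-- Choosing the separating formulas requires excluded middle.
module Submission where

open import Defs
open import Level using (0ℓ; lift; lower)
open import Axiom.ExcludedMiddle using (ExcludedMiddle)
open import Axiom.DoubleNegationElimination using (em⇒dne)
open import Function using (flip; _∘_)
open import Function.Bundles using (_⇔_; mk⇔; module Equivalence)
open import Function.Construct.Symmetry using (⇔-sym)
open import Data.Nat using (ℕ; _∸_; _≤_; _<_; z≤n; s≤s)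
open import Data.Nat.Properties using (n∸n≡0; m∸[m∸n]≡n; <⇒≤)
open import Data.Product using (Σ; _×_; _,_; proj₁; proj₂; map₂)
open import Data.Empty using (⊥-elim)
open import Data.Sum using (inj₁; inj₂)
open import Relation.Nullary using (¬_)
open import Relation.Nullary.Decidable using (True; toWitness; fromWitness)
open import Relation.Unary using (Pred; _∈_)
open import Relation.Binary using (Rel; REL)
open import Relation.Binary.PropositionalEquality using (_≡_; refl; sym; subst)

open Equivalence using (to; from)

module _ {X : Set} where

  open import Data.Nat using (zero; suc)

  Walk : Rel X 0ℓ → (ℕ → X) → Set
  Walk S π = ∀ n → π (suc n) ∈ 𝒞 S ⟪ π n ⟫

  closure-flip : {S : Rel X 0ℓ} {x y : X} → y ∈ 𝒞 S ⟪ x ⟫ → x ∈ 𝒞 (flip S) ⟪ y ⟫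
  closure-flip (inj₁ refl)             = inj₁ refl
  closure-flip (inj₂ (_ , refl , xSy)) = inj₂ (_ , refl , xSy)

  hop : X → X → ℕ → X
  hop x x' zero    = x
  hop x x' (suc _) = x'

  hop-walk : {S : Rel X 0ℓ} {x x' : X} → x' ∈ 𝒞 S ⟪ x ⟫ → Walk S (hop x x')
  hop-walk step zero    = step
  hop-walk step (suc _) = inj₁ refl

  reverse : ℕ → (ℕ → X) → ℕ → X
  reverse ℓ π k = π (ℓ ∸ k)

  -- Beyond ℓ the reversed walk stays at π 0, which is a trivial step.
  reverse-walk : {S : Rel X 0ℓ} {π : ℕ → X} → Walk S π → ∀ ℓ → Walk (flip S) (reverse ℓ π)
  reverse-walk     w zero    zero    = inj₁ refl
  reverse-walk     w zero    (suc k) = inj₁ refl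
  reverse-walk {S} w (suc ℓ) zero    = closure-flip {S = S} (w ℓ)
  reverse-walk {S} w (suc ℓ) (suc k) = reverse-walk {S} w ℓ k

  Forth : ∀ {ℓ} → Rel X 0ℓ → REL X X ℓ → X → X → Set ℓ
  Forth S B x₁ x₂ = (x₁' : X) → x₁' ∈ 𝒞 S ⟪ x₁ ⟫ → Σ X λ x₂' → x₂' ∈ 𝒞 S ⟪ x₂ ⟫ × B x₁' x₂'

  Forth-map : ∀ {ℓ ℓ'} {S : Rel X 0ℓ} {B : REL X X ℓ} {B' : REL X X ℓ'} →
              (∀ {a b} → B a b → B' a b) → ∀ {x₁ x₂} → Forth S B x₁ x₂ → Forth S B' x₁ x₂
  Forth-map f forth x₁' step = map₂ (map₂ f) (forth x₁' step)

  Simulation : Rel X 0ℓ → Rel X 0ℓ → Set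
  Simulation S B = ∀ {x₁ x₂} → B x₁ x₂ → Forth S B x₁ x₂

  lift-walk : {S B : Rel X 0ℓ} {π : ℕ → X} → Simulation S B → Walk S π → ∀ {y} → B (π 0) y →
              Σ (ℕ → X) λ π' → Walk S π' × π' 0 ≡ y × (∀ n → B (π n) (π' n))
  lift-walk {S} {B} {π} sim walk {y} related = proj₁ ∘ lifted , walk' , refl , proj₂ ∘ lifted
    where
      lifted : ∀ n → Σ X (B (π n))
      lifted zero    = y , related
      lifted (suc n) = map₂ proj₂ (sim (proj₂ (lifted n)) (π (suc n)) (walk n))

      walk' : Walk S (proj₁ ∘ lifted)
      walk' n = proj₁ (proj₂ (sim (proj₂ (lifted n)) (π (suc n)) (walk n)))

  lift-walk-backward : {S B : Rel X 0ℓ} {π : ℕ → X} → Simulation (flip S) B → Walk S π →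
                       ∀ ℓ {y} → B (π ℓ) y →
                       Σ (ℕ → X) λ π' → Walk S π' × π' ℓ ≡ y × (∀ j → j ≤ ℓ → B (π j) (π' j))
  lift-walk-backward {S} {B} {π} sim walk ℓ {y} related
    with lift-walk sim (reverse-walk {S} walk ℓ) related
  ... | σ , walkσ , σ0≡y , relatedσ =
    reverse ℓ σ , reverse-walk {flip S} walkσ ℓ ,
    subst (λ k → σ k ≡ y) (sym (n∸n≡0 ℓ)) σ0≡y ,
    λ j j≤ℓ → subst (λ k → B (π k) (σ (ℓ ∸ j))) (m∸[m∸n]≡n j≤ℓ) (relatedσ (ℓ ∸ j))

module _ {AP : Set} (M : QdCM AP) where

  open import Data.Nat using (zero; suc)
  open QdCM M
  open Semantics M

  walk⇒path : {π : ℕ → X} → Walk R π → IsPath π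
  walk⇒path walk N' m (inj₁ m∈N')                 = inj₁ (m , m∈N' , refl)
  walk⇒path walk N' _ (inj₂ (n , n∈N' , refl)) with walk n
  ... | inj₁ πn≡πsn          = inj₁ (n , n∈N' , πn≡πsn)
  ... | inj₂ (a , πn≡a , aR) = inj₂ (a , (n , n∈N' , πn≡a) , aR)

  -- Instantiate the path condition at the singleton N' = {n}.
  path⇒walk : {π : ℕ → X} → IsPath π → Walk R π
  path⇒walk path n with path (_≡ n) (suc n) (inj₂ (n , refl , refl))
  ... | inj₁ (_ , refl , πn≡πsn)          = inj₁ πn≡πsn
  ... | inj₂ (a , (_ , refl , πn≡a) , aR) = inj₂ (a , πn≡a , aR)

  IsBisimulation : Rel X 0ℓ → Set
  IsBisimulation B = (x₁ x₂ : X) → B x₁ x₂ →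
      SameSet (𝒱⁻¹ x₁) (𝒱⁻¹ x₂)
    × Forth R B x₁ x₂ × Forth R (flip B) x₂ x₁
    × Forth (flip R) B x₁ x₂ × Forth (flip R) (flip B) x₂ x₁

  module _ {B : Rel X 0ℓ} (bisim : IsBisimulation B) where

    bisimulation-flip : IsBisimulation (flip B)
    bisimulation-flip x₂ x₁ r with bisim x₁ x₂ r
    ... | atoms , forth→ , back→ , forth← , back← =
      ⇔-sym ∘ atoms , back→ , forth→ , back← , forth←

    simulation→ : Simulation R B
    simulation→ r = proj₁ (proj₂ (bisim _ _ r))

    simulation← : Simulation (flip R) B
    simulation← r = proj₁ (proj₂ (proj₂ (proj₂ (bisim _ _ r))))

  ⊨-bisimulation : {B : Rel X 0ℓ} → IsBisimulation B →
                   ∀ {x y} → B x y → ∀ Φ → x ⊨ Φ → y ⊨ Φ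
  ⊨-bisimulation bisim r (atom p) (lift x∈p) = lift (to (proj₁ (bisim _ _ r) p) x∈p)
  ⊨-bisimulation bisim r (¬ᶠ Φ) x⊭Φ y⊨Φ =
    x⊭Φ (⊨-bisimulation (bisimulation-flip bisim) r Φ y⊨Φ)
  ⊨-bisimulation bisim r (⋀ Φ) x⊨Φ i = ⊨-bisimulation bisim r (Φ i) (x⊨Φ i)
  ⊨-bisimulation bisim r (ρ→ Φ₁ Φ₂) (π , path , ℓ , refl , π⊨Φ₁ , π⊨Φ₂)
    with lift-walk (simulation→ bisim) (path⇒walk path) r
  ... | π' , walk' , π'0≡y , related =
    π' , walk⇒path walk' , ℓ , π'0≡y ,
    ⊨-bisimulation bisim (related ℓ) Φ₁ π⊨Φ₁ ,
    λ j 0<j j<ℓ → ⊨-bisimulation bisim (related j) Φ₂ (π⊨Φ₂ j 0<j j<ℓ)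
  ⊨-bisimulation bisim r (ρ← Φ₁ Φ₂) (π , path , ℓ , refl , π⊨Φ₁ , π⊨Φ₂)
    with lift-walk-backward (simulation← bisim) (path⇒walk path) ℓ r
  ... | π' , walk' , π'ℓ≡y , related =
    π' , walk⇒path walk' , ℓ , π'ℓ≡y ,
    ⊨-bisimulation bisim (related 0 z≤n) Φ₁ π⊨Φ₁ ,
    λ j 0<j j<ℓ → ⊨-bisimulation bisim (related j (<⇒≤ j<ℓ)) Φ₂ (π⊨Φ₂ j 0<j j<ℓ)

  bisimilar⇒logEquiv : ∀ {x₁ x₂} → CBisimilar x₁ x₂ → LogEquiv x₁ x₂
  bisimilar⇒logEquiv (B , (_ , bisim) , r) Φ =
    mk⇔ (⊨-bisimulation bisim r Φ) (⊨-bisimulation (bisimulation-flip bisim) r Φ)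

  logEquiv-sym : ∀ {x₁ x₂} → LogEquiv x₁ x₂ → LogEquiv x₂ x₁
  logEquiv-sym x₁≈x₂ = ⇔-sym ∘ x₁≈x₂

  logEquiv⇒sameAtoms : ∀ {x₁ x₂} → LogEquiv x₁ x₂ → SameSet (𝒱⁻¹ x₁) (𝒱⁻¹ x₂)
  logEquiv⇒sameAtoms x₁≈x₂ p =
    mk⇔ (lower ∘ to (x₁≈x₂ (atom p)) ∘ lift) (lower ∘ from (x₁≈x₂ (atom p)) ∘ lift)

  ⊥ᶠ : Formula AP
  ⊥ᶠ = ¬ᶠ (⋀ ⊥-elim)

  ⊭⊥ᶠ : ∀ {x} → ¬ x ⊨ ⊥ᶠ
  ⊭⊥ᶠ x⊨⊥ᶠ = x⊨⊥ᶠ λ ()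

  ◇→ ◇← : Formula AP → Formula AP
  ◇→ Φ = ρ→ Φ ⊥ᶠ
  ◇← Φ = ρ← Φ ⊥ᶠ

  no-interior-below-1 : {π : ℕ → X} → ∀ j → 0 < j → j < 1 → π j ⊨ ⊥ᶠ
  no-interior-below-1 (suc _) _ (s≤s ())

  ◇→-intro : ∀ {x x' Φ} → x' ∈ C→ ⟪ x ⟫ → x' ⊨ Φ → x ⊨ ◇→ Φ
  ◇→-intro step x'⊨Φ =
    hop _ _ , walk⇒path (hop-walk {S = R} step) , 1 , refl , x'⊨Φ , no-interior-below-1

  ◇→-elim : ∀ {x Φ} → x ⊨ ◇→ Φ → Σ X λ x' → x' ∈ C→ ⟪ x ⟫ × x' ⊨ Φ
  ◇→-elim (π , _    , zero       , refl , π⊨Φ , _) = π 0 , inj₁ refl , π⊨Φ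
  ◇→-elim (π , path , 1          , refl , π⊨Φ , _) = π 1 , path⇒walk path 0 , π⊨Φ
  ◇→-elim (π , _    , suc (suc _) , _   , _   , π⊨⊥ᶠ) =
    ⊥-elim (⊭⊥ᶠ (π⊨⊥ᶠ 1 (s≤s z≤n) (s≤s (s≤s z≤n))))

  ◇←-intro : ∀ {x x' Φ} → x' ∈ C← ⟪ x ⟫ → x' ⊨ Φ → x ⊨ ◇← Φ
  ◇←-intro step x'⊨Φ =
    hop _ _ , walk⇒path (hop-walk {S = R} (closure-flip {S = flip R} step)) , 1 , refl , x'⊨Φ ,
    no-interior-below-1

  ◇←-elim : ∀ {x Φ} → x ⊨ ◇← Φ → Σ X λ x' → x' ∈ C← ⟪ x ⟫ × x' ⊨ Φ
  ◇←-elim (π , _    , zero       , refl , π⊨Φ , _) = π 0 , inj₁ refl , π⊨Φ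
  ◇←-elim (π , path , 1          , refl , π⊨Φ , _) = π 0 , closure-flip {S = R} (path⇒walk path 0) , π⊨Φ
  ◇←-elim (π , _    , suc (suc _) , _   , _   , π⊨⊥ᶠ) =
    ⊥-elim (⊭⊥ᶠ (π⊨⊥ᶠ 1 (s≤s z≤n) (s≤s (s≤s z≤n))))

  module _ (em : ExcludedMiddle (Level.suc 0ℓ)) where

    private
      dne : {P : Set₁} → ¬ ¬ P → P
      dne = em⇒dne em

    separating : ∀ {x y} → ¬ LogEquiv x y → Σ (Formula AP) λ Φ → x ⊨ Φ × ¬ y ⊨ Φ
    separating x≉y = dne λ none → x≉y λ Φ →
      mk⇔ (λ x⊨Φ → dne λ y⊭Φ → none (Φ , x⊨Φ , y⊭Φ))
          (λ y⊨Φ → dne λ x⊭Φ → none (¬ᶠ Φ , x⊭Φ , λ y⊭Φ → y⊭Φ y⊨Φ))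

    characteristic : ∀ {x} (P : Pred X 0ℓ) → (∀ {y} → P y → ¬ LogEquiv x y) →
                     Σ (Formula AP) λ Ψ → x ⊨ Ψ × (∀ {y} → P y → ¬ y ⊨ Ψ)
    characteristic {x} P x≉P =
      ⋀ (proj₁ ∘ separate) , proj₁ ∘ proj₂ ∘ separate ,
      λ y∈P y⊨Ψ → proj₂ (proj₂ (separate (_ , y∈P))) (y⊨Ψ (_ , y∈P))
      where
        separate : (y : Σ X P) → Σ (Formula AP) λ Φ → x ⊨ Φ × ¬ proj₁ y ⊨ Φ
        separate (_ , y∈P) = separating (x≉P y∈P)

    forth-logEquiv : (◇ : Formula AP → Formula AP) (S : Rel X 0ℓ) →
      (∀ {x x' Φ} → x' ∈ 𝒞 S ⟪ x ⟫ → x' ⊨ Φ → x ⊨ ◇ Φ) →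
      (∀ {x Φ} → x ⊨ ◇ Φ → Σ X λ x' → x' ∈ 𝒞 S ⟪ x ⟫ × x' ⊨ Φ) →
      ∀ {x₁ x₂} → LogEquiv x₁ x₂ → Forth S LogEquiv x₁ x₂
    forth-logEquiv ◇ S intro elim {x₂ = x₂} x₁≈x₂ x₁' step = dne λ none →
      let Ψ , x₁'⊨Ψ , steps₂⊭Ψ =
            characteristic (𝒞 S ⟪ x₂ ⟫) (λ step' x₁'≈ → none (_ , step' , x₁'≈))
          _ , step₂ , x₂'⊨Ψ = elim (to (x₁≈x₂ (◇ Ψ)) (intro step x₁'⊨Ψ))
      in steps₂⊭Ψ step₂ x₂'⊨Ψ

    -- Logical equivalence lives in Set₁, but a bisimulation must be a relation in Set.
    _≈ᴸ_ : Rel X 0ℓ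
    x ≈ᴸ y = True (em {LogEquiv x y})

    logEquiv-forth→ : ∀ {x₁ x₂} → LogEquiv x₁ x₂ → Forth R LogEquiv x₁ x₂
    logEquiv-forth→ = forth-logEquiv ◇→ R ◇→-intro ◇→-elim

    logEquiv-forth← : ∀ {x₁ x₂} → LogEquiv x₁ x₂ → Forth (flip R) LogEquiv x₁ x₂
    logEquiv-forth← = forth-logEquiv ◇← (flip R) ◇←-intro ◇←-elim

    ≈ᴸ-isBisimulation : IsBisimulation _≈ᴸ_
    ≈ᴸ-isBisimulation x₁ x₂ r =
      logEquiv⇒sameAtoms x₁≈x₂ ,
      Forth-map fromWitness (logEquiv-forth→ x₁≈x₂) ,
      Forth-map (fromWitness ∘ logEquiv-sym) (logEquiv-forth→ (logEquiv-sym x₁≈x₂)) ,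
      Forth-map fromWitness (logEquiv-forth← x₁≈x₂) ,
      Forth-map (fromWitness ∘ logEquiv-sym) (logEquiv-forth← (logEquiv-sym x₁≈x₂))
      where
        x₁≈x₂ : LogEquiv x₁ x₂
        x₁≈x₂ = toWitness r

    logEquiv⇒bisimilar : ∀ {x₁ x₂} → LogEquiv x₁ x₂ → CBisimilar x₁ x₂
    logEquiv⇒bisimilar x₁≈x₂ =
      _≈ᴸ_ , ((_ , _ , fromWitness x₁≈x₂) , ≈ᴸ-isBisimulation) , fromWitness x₁≈x₂

open import Level using (suc; zero)

corollary3 : ExcludedMiddle (suc zero) →
    {AP : Set} (M : QdCM AP) (x₁ x₂ : QdCM.X M) →
      Semantics.LogEquiv M x₁ x₂ ⇔ Semantics.CBisimilar M x₁ x₂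
corollary3 em M x₁ x₂ = mk⇔ (logEquiv⇒bisimilar M em) (bisimilar⇒logEquiv M)
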